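{- Let $n\le m$ be positive integers and let $(x_1,\ldots,x_n)\in\mathbb{Z}^n$ satisfy $2^{2^{m-1}}<|x_1|\le 2^{2^m}$. If the statement $\Lambda_n$ fails for $(x_1,\ldots,x_n)$, then the statement $\Lambda_m$ fails for the $m$-tuple $(x_1,\ldots,x_1,x_2,\ldots,x_n)\in\mathbb{Z}^m$ in which $x_1$ is repeated $m-n+1$ times.
   Context: For a positive integer $k$ and $(x_1,\ldots,x_k)\in\mathbb{Z}^k$, "$\Lambda_k$ holds for $(x_1,\ldots,x_k)$" means: there exist $y_1,\ldots,y_k\in\mathbb{Z}$ such that $\bigl(2^{2^{k-1}}<|x_1|\Rightarrow(|x_1|<|y_1|\vee\ldots\vee|x_1|<|y_k|)\bigr)$, and for all $i,j,l\in\{1,\ldots,k\}$ ($x_i+x_j=x_l\Rightarrow y_i+y_j=y_l$), and for all $i,j,l\in\{1,\ldots,k\}$ ($x_i\cdot x_j=x_l\Rightarrow y_i\cdot y_j=y_l$). "$\Lambda_k$ fails for $(x_1,\ldots,x_k)$" means no such $y_1,\ldots,y_k$ exist. -}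

module Defs where

open import Data.Nat as ℕ using (ℕ; zero; suc; _∸_; _^_)
open import Data.Integer as ℤ using (ℤ; ∣_∣)
open import Data.Fin using (Fin; zero; toℕ; fromℕ<)
open import Data.Product using (Σ; ∃; _×_)
open import Relation.Nullary using (¬_)
open import Relation.Binary.PropositionalEquality using (_≡_)
open import Relation.Nullary.Decidable using (yes; no)

-- A k-tuple (x_1,...,x_k) of integers, for k = suc k', is a function Fin (suc k') → ℤ;
-- x_1 is the value at index zero.

Λ : (k' : ℕ) → (Fin (suc k') → ℤ) → Set
Λ k' x = Σ (Fin (suc k') → ℤ) λ y →
    ((2 ^ (2 ^ k')) ℕ.< ∣ x zero ∣ → ∃ λ i → ∣ x zero ∣ ℕ.< ∣ y i ∣)
  × (∀ i j l → x i ℤ.+ x j ≡ x l → y i ℤ.+ y j ≡ y l)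
  × (∀ i j l → x i ℤ.* x j ≡ x l → y i ℤ.* y j ≡ y l)

ΛFails : (k' : ℕ) → (Fin (suc k') → ℤ) → Set
ΛFails k' x = ¬ Λ k' x

-- Given x : Fin (suc n') → ℤ (an n-tuple, n = suc n'), the m-tuple (m = suc m', n ≤ m)
-- (x_1,...,x_1,x_2,...,x_n) with x_1 repeated m-n+1 times:
-- index i (0-based) maps to x at index i ∸ (m ∸ n) when i ≥ m ∸ n, else x_1.
-- x at 0-based natural index j, defaulting to x_1 when j is out of range
-- (never out of range in the use below, since n ≤ m).
at : (n' : ℕ) → (Fin (suc n') → ℤ) → ℕ → ℤ
at n' x j with j ℕ.<? suc n'
... | yes p = x (fromℕ< p)
... | no _ = x zero

pad : (n' m' : ℕ) → (Fin (suc n') → ℤ) → Fin (suc m') → ℤ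
pad n' m' x i with (m' ∸ n') ℕ.≤? toℕ i
... | no _ = x zero
... | yes _ = at n' x (toℕ i ∸ (m' ∸ n'))

-- Write z = pad n' m' x for the m-tuple (x₁,…,x₁,x₂,…,xₙ).  The proof is the
-- contrapositive: from a witness y for Λₘ(z) we build a witness for Λₙ(x).
--
-- * Respect of equations is pulled back along reindexings: if σ : Fin a → Fin b
--   satisfies z ∘ σ = x, then every x-equation xᵢ+xⱼ=xₗ or xᵢ·xⱼ=xₗ is a
--   z-equation, so y ∘ σ respects the equations of x ('respects-pullback').
-- * The padded tuple is covered by such reindexings: every index i of z lies in
--   the image of some σ with z ∘ σ = x (the shift j ↦ j + (m−n) hits the tail,
--   and redirecting x₁ to i hits the repeated block), and z₁ = x₁.
-- * Hence Λ descends from any covering tuple with the same first entry, as soon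
--   as |z₁| exceeds the threshold 2^(2^(m−1)) ('Λ-descends'): the large value
--   |y i| > |z₁| = |x₁| is reached by y ∘ σ for the σ covering i.
module Submission where

open import Defs
open import Data.Nat using (ℕ; suc; _≤_; _<_; _^_; s≤s)
open import Data.Integer using (ℤ; ∣_∣)
open import Data.Fin using (Fin; zero)
import Data.Nat as ℕ
open import Data.Nat.Properties
import Data.Integer as ℤ
open import Data.Fin using (toℕ; fromℕ<) renaming (suc to fsuc)
open import Data.Fin.Properties
  using (toℕ-fromℕ<; fromℕ<-toℕ; toℕ-injective; toℕ<n; toℕ≤pred[n])
open import Data.Product using (Σ; ∃; _×_; _,_)
open import Data.Empty using (⊥-elim)
open import Function using (_∘_)
open import Relation.Binary.PropositionalEquality
open import Relation.Nullary.Decidable using (yes; no)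

Respects : {a : ℕ} → (Fin a → ℤ) → (Fin a → ℤ) → Set
Respects x y =
    (∀ i j l → x i ℤ.+ x j ≡ x l → y i ℤ.+ y j ≡ y l)
  × (∀ i j l → x i ℤ.* x j ≡ x l → y i ℤ.* y j ≡ y l)

respects-pullback : {a b : ℕ} (x : Fin a → ℤ) (z y : Fin b → ℤ)
  (σ : Fin a → Fin b) → (∀ j → z (σ j) ≡ x j) →
  Respects z y → Respects x (y ∘ σ)
respects-pullback x z y σ zσ≡x (add , mul) =
    (λ i j l e → add (σ i) (σ j) (σ l) (transport ℤ._+_ i j l e))
  , (λ i j l e → mul (σ i) (σ j) (σ l) (transport ℤ._*_ i j l e))
  where
  transport : (_∙_ : ℤ → ℤ → ℤ) → ∀ i j l →
    x i ∙ x j ≡ x l → z (σ i) ∙ z (σ j) ≡ z (σ l)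
  transport _∙_ i j l e =
    trans (cong₂ _∙_ (zσ≡x i) (zσ≡x j)) (trans e (sym (zσ≡x l)))

Covers : {a b : ℕ} → (Fin a → ℤ) → (Fin b → ℤ) → Fin b → Set
Covers {a} {b} x z i =
  Σ (Fin a → Fin b) λ σ → (∀ j → z (σ j) ≡ x j) × ∃ λ j → σ j ≡ i

Λ-descends : (n' m' : ℕ) (x : Fin (suc n') → ℤ) (z : Fin (suc m') → ℤ) →
  z zero ≡ x zero → (∀ i → Covers x z i) →
  2 ^ (2 ^ m') < ∣ x zero ∣ → Λ m' z → Λ n' x
Λ-descends n' m' x z z₁≡x₁ cover big (y , reach , respects)
  with reach (subst (λ t → 2 ^ (2 ^ m') < ∣ t ∣) (sym z₁≡x₁) big)
... | i , z₁<yᵢ with cover i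
... | σ , zσ≡x , j , σj≡i =
  y ∘ σ , (λ _ → j , x₁<yσⱼ) , respects-pullback x z y σ zσ≡x respects
  where
  x₁<yσⱼ : ∣ x zero ∣ < ∣ y (σ j) ∣
  x₁<yσⱼ = subst₂ (λ s t → ∣ s ∣ < ∣ y t ∣) z₁≡x₁ (sym σj≡i) z₁<yᵢ

module Padding (n' m' : ℕ) (n'≤m' : n' ≤ m') (x : Fin (suc n') → ℤ) where

  gap : ℕ
  gap = m' ℕ.∸ n'

  private
    z : Fin (suc m') → ℤ
    z = pad n' m' x

  at-toℕ : ∀ j → at n' x (toℕ j) ≡ x j
  at-toℕ j with toℕ j ℕ.<? suc n'
  ... | yes p = cong x (fromℕ<-toℕ j p)
  ... | no ¬p = ⊥-elim (¬p (toℕ<n j))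

  pad-tail : ∀ i → gap ≤ toℕ i → z i ≡ at n' x (toℕ i ℕ.∸ gap)
  pad-tail i gap≤i with gap ℕ.≤? toℕ i
  ... | yes _ = refl
  ... | no gap≰i = ⊥-elim (gap≰i gap≤i)

  pad-head : ∀ i → toℕ i < gap → z i ≡ x zero
  pad-head i i<gap with gap ℕ.≤? toℕ i
  ... | no _ = refl
  ... | yes gap≤i = ⊥-elim (<⇒≱ i<gap gap≤i)

  pad-first : z zero ≡ x zero
  pad-first with gap ℕ.≤? 0
  ... | no _ = refl
  ... | yes _ = trans (cong (at n' x) (0∸n≡0 gap)) (at-toℕ zero)

  shift-bound : ∀ (j : Fin (suc n')) → toℕ j ℕ.+ gap < suc m'
  shift-bound j = s≤s (begin
      toℕ j ℕ.+ gap ≤⟨ +-monoˡ-≤ gap (toℕ≤pred[n] j) ⟩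
      n' ℕ.+ gap    ≡⟨ m+[n∸m]≡n n'≤m' ⟩
      m'            ∎)
    where open ≤-Reasoning

  shift : Fin (suc n') → Fin (suc m')
  shift j = fromℕ< (shift-bound j)

  toℕ-shift : ∀ j → toℕ (shift j) ≡ toℕ j ℕ.+ gap
  toℕ-shift j = toℕ-fromℕ< (shift-bound j)

  pad-shift : ∀ j → z (shift j) ≡ x j
  pad-shift j = begin
      z (shift j)                           ≡⟨ pad-tail (shift j) gap≤shift ⟩
      at n' x (toℕ (shift j) ℕ.∸ gap)       ≡⟨ cong (λ t → at n' x (t ℕ.∸ gap)) (toℕ-shift j) ⟩
      at n' x (toℕ j ℕ.+ gap ℕ.∸ gap)       ≡⟨ cong (at n' x) (m+n∸n≡m (toℕ j) gap) ⟩
      at n' x (toℕ j)                       ≡⟨ at-toℕ j ⟩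
      x j                                   ∎
    where
    open ≡-Reasoning
    gap≤shift : gap ≤ toℕ (shift j)
    gap≤shift = subst (gap ≤_) (sym (toℕ-shift j)) (m≤n+m gap (toℕ j))

  shift-onto-tail : ∀ i → gap ≤ toℕ i → ∃ λ j → shift j ≡ i
  shift-onto-tail i gap≤i = fromℕ< i-gap<n , toℕ-injective (begin
      toℕ (shift (fromℕ< i-gap<n))       ≡⟨ toℕ-shift (fromℕ< i-gap<n) ⟩
      toℕ (fromℕ< i-gap<n) ℕ.+ gap       ≡⟨ cong (ℕ._+ gap) (toℕ-fromℕ< i-gap<n) ⟩
      toℕ i ℕ.∸ gap ℕ.+ gap              ≡⟨ m∸n+n≡m gap≤i ⟩
      toℕ i                              ∎)
    where
    open ≡-Reasoning
    i-gap<n : toℕ i ℕ.∸ gap < suc n'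
    i-gap<n = s≤s (≤-trans (∸-monoˡ-≤ gap (toℕ≤pred[n] i)) (≤-reflexive (m∸[m∸n]≡n n'≤m')))

  -- Every index of the padded tuple is covered: tail indices by the shift, and
  -- a head index i (a copy of x₁) by the shift redirected to send x₁ to i.
  pad-covered : ∀ i → Covers x z i
  pad-covered i with gap ℕ.≤? toℕ i
  ... | yes gap≤i = shift , pad-shift , shift-onto-tail i gap≤i
  ... | no gap≰i = redirect , pad-redirect , zero , refl
    where
    redirect : Fin (suc n') → Fin (suc m')
    redirect zero     = i
    redirect (fsuc j) = shift (fsuc j)

    pad-redirect : ∀ j → z (redirect j) ≡ x j
    pad-redirect zero     = pad-head i (≰⇒> gap≰i)
    pad-redirect (fsuc j) = pad-shift (fsuc j)

lemma3 : (n' m' : ℕ) → n' ≤ m' → (x : Fin (suc n') → ℤ) →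
    2 ^ (2 ^ m') < ∣ x zero ∣ → ∣ x zero ∣ ≤ 2 ^ (2 ^ suc m') →
    ΛFails n' x → ΛFails m' (pad n' m' x)
lemma3 n' m' n'≤m' x big _ Λₙ-fails Λₘ-holds =
  Λₙ-fails (Λ-descends n' m' x (pad n' m' x) pad-first pad-covered big Λₘ-holds)
  where open Padding n' m' n'≤m' x
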